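{- Let $G$ be an $(r,c)$-graph on $n$ vertices with $n \equiv 1$ or $2 \pmod 3$. Then $c \equiv 0 \pmod 3$.
   Context: All graphs are finite and simple. For a vertex $v$, $e(v)$ denotes the number of edges of the subgraph induced by the open neighbourhood of $v$. An $(r,c)$-graph is an $r$-regular graph with $e(v) = c$ for every vertex $v$. -}

module Defs where

open import Data.Nat using (ℕ; _+_)
open import Data.Bool using (Bool; true; false; _∧_)
open import Data.Fin using (Fin; _<_)
open import Data.Fin.Properties using (_<?_)
open import Data.List using (List; length; filter; allFin; cartesianProduct)
open import Data.Product using (_×_; _,_; proj₁; proj₂)
open import Relation.Binary.PropositionalEquality using (_≡_)
open import Relation.Nullary.Decidable using (Dec; _×-dec_)
open import Data.Bool.Properties using (T?)
open import Data.Bool using (T)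

record SimpleGraph (n : ℕ) : Set where
  field
    adj       : Fin n → Fin n → Bool
    symmetric : ∀ u v → adj u v ≡ adj v u
    loopless  : ∀ v → adj v v ≡ false

open SimpleGraph public

count : ∀ {n} → (Fin n → Bool) → ℕ
count {n} p = length (filter (λ v → T? (p v)) (allFin n))

degree : ∀ {n} → SimpleGraph n → Fin n → ℕ
degree G v = count (adj G v)

-- e(v): number of edges of the subgraph induced by the open
-- neighbourhood of v, i.e. number of pairs (u , w) with u < w,
-- u and w both adjacent to v, and u adjacent to w.
e : ∀ {n} → SimpleGraph n → Fin n → ℕ
e {n} G v = length (filter P (cartesianProduct (allFin n) (allFin n)))
  where
  P : (p : Fin n × Fin n) → Dec (proj₁ p < proj₂ p × T (adj G v (proj₁ p) ∧ adj G v (proj₂ p) ∧ adj G (proj₁ p) (proj₂ p)))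
  P (u , w) = (u <? w) ×-dec T? (adj G v u ∧ adj G v w ∧ adj G u w)

IsRegular : ∀ {n} → SimpleGraph n → ℕ → Set
IsRegular G r = ∀ v → degree G v ≡ r

IsRCGraph : ∀ {n} → SimpleGraph n → ℕ → ℕ → Set
IsRCGraph G r c = IsRegular G r × (∀ v → e G v ≡ c)

-- Summing e(v) over all vertices counts every triangle {a < b < c} once from each of its
-- three corners, so ∑ e(v) = 3 · #triangles. For an (r,c)-graph the sum is n · c, and 3 ∣ n · c
-- with 3 ∤ n forces 3 ∣ c.
module Submission where

open import Defs
open import Data.Nat using (ℕ; _%_)
open import Data.Sum using (_⊎_)
open import Relation.Binary.PropositionalEquality using (_≡_)

open import Data.Bool using (Bool; true; false; _∧_)
open import Data.Bool.Properties using (∧-comm; ∧-assoc)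
open import Data.Fin as F using (Fin; zero; suc; _≟_)
open import Data.Fin.Properties using (_<?_; <-cmp; <-asym; <-trans)
open import Data.List using (_++_; map; length; filter; tabulate; cartesianProduct)
open import Data.List.Properties using (filter-++; length-++; map-tabulate)
open import Data.Nat using (zero; suc; _+_; _*_)
open import Data.Nat.Divisibility using (_∣_; m∣m*n; n∣m⇒m%n≡0)
open import Data.Nat.Primality using (prime?; euclidsLemma)
open import Data.Nat.Properties using (0≢1+n; +-identityʳ; *-zeroʳ; *-distribʳ-+; +-0-commutativeMonoid)
open import Data.Nat.Tactic.RingSolver using (solve-∀)
open import Data.Product using (_×_; _,_)
open import Data.Sum using (inj₁; inj₂; [_,_])
open import Function using (_∘_; id)
open import Relation.Binary using (tri<; tri≈; tri>)
open import Relation.Binary.PropositionalEquality using (refl; sym; trans; cong; cong₂; subst; _≢_; module ≡-Reasoning)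
open import Relation.Nullary using (yes; no; does; ¬_; contradiction)
open import Relation.Nullary.Decidable using (toWitness; dec-true; dec-false)
open import Relation.Unary using (Pred; Decidable)

open import Algebra.Properties.CommutativeMonoid.Sum +-0-commutativeMonoid
  using (sum-syntax; sum-cong-≗; ∑-distrib-+; ∑-comm)

indicator : Bool → ℕ
indicator true  = 1
indicator false = 0

indicator-∧ : ∀ x y → indicator (x ∧ y) ≡ indicator x * indicator y
indicator-∧ true  y = sym (+-identityʳ (indicator y))
indicator-∧ false y = refl

module _ {a p} {A : Set a} {P : Pred A p} (P? : Decidable P) where

  length-filter-++ : ∀ xs ys →
    length (filter P? (xs ++ ys)) ≡ length (filter P? xs) + length (filter P? ys)
  length-filter-++ xs ys = trans (cong length (filter-++ P? xs ys)) (length-++ (filter P? xs))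

  length-filter-tabulate : ∀ {n} (f : Fin n → A) →
    length (filter P? (tabulate f)) ≡ (∑[ i < n ] indicator (does (P? (f i))))
  length-filter-tabulate {zero}  f = refl
  length-filter-tabulate {suc n} f with does (P? (f zero))
  ... | true  = cong suc (length-filter-tabulate (f ∘ suc))
  ... | false = length-filter-tabulate (f ∘ suc)

length-filter-cartesianProduct :
  ∀ {a b p} {A : Set a} {B : Set b} {P : Pred (A × B) p} (P? : Decidable P) {m n}
  (f : Fin m → A) (g : Fin n → B) →
  length (filter P? (cartesianProduct (tabulate f) (tabulate g)))
    ≡ (∑[ i < m ] ∑[ j < n ] indicator (does (P? (f i , g j))))
length-filter-cartesianProduct P? {zero}  f g = refl
length-filter-cartesianProduct P? {suc m} {n} f g = begin
  length (filter P? (map (f zero ,_) (tabulate g) ++ cartesianProduct (tabulate (f ∘ suc)) (tabulate g)))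
    ≡⟨ length-filter-++ P? (map (f zero ,_) (tabulate g)) _ ⟩
  length (filter P? (map (f zero ,_) (tabulate g)))
    + length (filter P? (cartesianProduct (tabulate (f ∘ suc)) (tabulate g)))
    ≡⟨ cong₂ _+_ first-row (length-filter-cartesianProduct P? (f ∘ suc) g) ⟩
  ∑[ j < n ] indicator (does (P? (f zero , g j)))
    + ∑[ i < m ] ∑[ j < n ] indicator (does (P? (f (suc i) , g j))) ∎
  where
  open ≡-Reasoning
  first-row : length (filter P? (map (f zero ,_) (tabulate g)))
            ≡ (∑[ j < n ] indicator (does (P? (f zero , g j))))
  first-row = trans (cong (length ∘ filter P?) (map-tabulate g (f zero ,_)))
                    (length-filter-tabulate P? ((f zero ,_) ∘ g))

module _ {n : ℕ} where

  ⟦_<_⟧ : Fin n → Fin n → ℕ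
  ⟦ a < b ⟧ = indicator (does (a <? b))

  ⟦<⟧≡1 : ∀ {a b} → a F.< b → ⟦ a < b ⟧ ≡ 1
  ⟦<⟧≡1 {a} {b} a<b = cong indicator (dec-true (a <? b) a<b)

  ⟦<⟧≡0 : ∀ {a b} → ¬ a F.< b → ⟦ a < b ⟧ ≡ 0
  ⟦<⟧≡0 {a} {b} a≮b = cong indicator (dec-false (a <? b) a≮b)

  -- If b < c then exactly one of a < b, b < a < c, c < a holds; if b ≮ c every term vanishes.
  ⟦<⟧-split : ∀ {a b c} → a ≢ b → a ≢ c →
    ⟦ b < c ⟧ ≡ ⟦ a < b ⟧ * ⟦ b < c ⟧ + ⟦ b < a ⟧ * ⟦ a < c ⟧ + ⟦ b < c ⟧ * ⟦ c < a ⟧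
  ⟦<⟧-split {a} {b} {c} a≢b a≢c with b <? c | <-cmp a b
  ... | _       | tri≈ _ a≡b _ = contradiction a≡b a≢b
  ... | yes b<c | tri< a<b _ b≮a
    rewrite ⟦<⟧≡1 b<c | ⟦<⟧≡1 a<b | ⟦<⟧≡0 b≮a | ⟦<⟧≡0 (<-asym (<-trans a<b b<c)) = refl
  ... | no b≮c | tri< a<b _ b≮a rewrite ⟦<⟧≡0 b≮c | ⟦<⟧≡1 a<b | ⟦<⟧≡0 b≮a = refl
  ... | no b≮c | tri> a≮b _ b<a
    rewrite ⟦<⟧≡0 b≮c | ⟦<⟧≡0 a≮b | ⟦<⟧≡1 b<a | ⟦<⟧≡0 (λ a<c → b≮c (<-trans b<a a<c)) = refl
  ... | yes b<c | tri> a≮b _ b<a rewrite ⟦<⟧≡1 b<c | ⟦<⟧≡0 a≮b | ⟦<⟧≡1 b<a with <-cmp a c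
  ...   | tri< a<c _ c≮a rewrite ⟦<⟧≡1 a<c | ⟦<⟧≡0 c≮a = refl
  ...   | tri≈ _ a≡c _ = contradiction a≡c a≢c
  ...   | tri> a≮c _ c<a rewrite ⟦<⟧≡0 a≮c | ⟦<⟧≡1 c<a = refl

module _ {n : ℕ} where

  ∑³ : (Fin n → Fin n → Fin n → ℕ) → ℕ
  ∑³ f = ∑[ a < n ] ∑[ b < n ] ∑[ c < n ] f a b c

  ∑³-cong : ∀ {f g} → (∀ a b c → f a b c ≡ g a b c) → ∑³ f ≡ ∑³ g
  ∑³-cong f≡g = sum-cong-≗ λ a → sum-cong-≗ λ b → sum-cong-≗ λ c → f≡g a b c

  ∑³-distrib-+ : ∀ f g → ∑³ (λ a b c → f a b c + g a b c) ≡ ∑³ f + ∑³ g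
  ∑³-distrib-+ f g = trans
    (sum-cong-≗ λ a → trans (sum-cong-≗ λ b → ∑-distrib-+ (f a b) (g a b))
                            (∑-distrib-+ (λ b → ∑[ c < n ] f a b c) (λ b → ∑[ c < n ] g a b c)))
    (∑-distrib-+ (λ a → ∑[ b < n ] ∑[ c < n ] f a b c) (λ a → ∑[ b < n ] ∑[ c < n ] g a b c))

  ∑³-distrib-+₃ : ∀ f g h →
    ∑³ (λ a b c → f a b c + g a b c + h a b c) ≡ ∑³ f + ∑³ g + ∑³ h
  ∑³-distrib-+₃ f g h = trans (∑³-distrib-+ (λ a b c → f a b c + g a b c) h)
                              (cong (_+ ∑³ h) (∑³-distrib-+ f g))

  ∑³-swap₁₂ : ∀ f → ∑³ (λ a b c → f b a c) ≡ ∑³ f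
  ∑³-swap₁₂ f = ∑-comm (λ a b → ∑[ c < n ] f b a c)

  ∑³-rotate : ∀ f → ∑³ (λ a b c → f b c a) ≡ ∑³ f
  ∑³-rotate f = trans (∑-comm (λ a b → ∑[ c < n ] f b c a))
                      (sum-cong-≗ λ b → ∑-comm (λ a c → f b c a))

module SymmetricWeight {n : ℕ} (t : Fin n → Fin n → Fin n → ℕ)
  (t-swap : ∀ a b c → t a b c ≡ t b a c)
  (t-rotate : ∀ a b c → t a b c ≡ t b c a)
  (t-degenerate : ∀ a c → t a a c ≡ 0)
  where

  ascending : Fin n → Fin n → Fin n → ℕ
  ascending a b c = ⟦ a < b ⟧ * ⟦ b < c ⟧ * t a b c

  t≡0⊎distinct : ∀ a b c → t a b c ≡ 0 ⊎ (a ≢ b × a ≢ c)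
  t≡0⊎distinct a b c with a ≟ b | a ≟ c
  ... | yes refl | _        = inj₁ (t-degenerate a c)
  ... | no _     | yes refl = inj₁ (trans (t-swap a b a) (trans (t-rotate b a a) (t-degenerate a b)))
  ... | no a≢b   | no a≢c   = inj₂ (a≢b , a≢c)

  position-split : ∀ a b c → ⟦ b < c ⟧ * t a b c ≡ ascending a b c + ascending b a c + ascending b c a
  position-split a b c = begin
    ⟦ b < c ⟧ * t a b c                   ≡⟨ split-weight ⟩
    (p + q + r) * t a b c                 ≡⟨ *-distribʳ-+ (t a b c) (p + q) r ⟩
    (p + q) * t a b c + r * t a b c       ≡⟨ cong (_+ r * t a b c) (*-distribʳ-+ (t a b c) p q) ⟩
    p * t a b c + q * t a b c + r * t a b c
      ≡⟨ cong₂ (λ x y → p * t a b c + q * x + r * y) (t-swap a b c) (t-rotate a b c) ⟩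
    p * t a b c + q * t b a c + r * t b c a ∎
    where
    open ≡-Reasoning
    p q r : ℕ
    p = ⟦ a < b ⟧ * ⟦ b < c ⟧
    q = ⟦ b < a ⟧ * ⟦ a < c ⟧
    r = ⟦ b < c ⟧ * ⟦ c < a ⟧
    split-weight : ⟦ b < c ⟧ * t a b c ≡ (p + q + r) * t a b c
    split-weight with t≡0⊎distinct a b c
    ... | inj₁ t≡0 rewrite t≡0 | *-zeroʳ ⟦ b < c ⟧ | *-zeroʳ (p + q + r) = refl
    ... | inj₂ (a≢b , a≢c) = cong (_* t a b c) (⟦<⟧-split a≢b a≢c)

  ∑-pairs≡3*∑-ascending : ∑³ (λ a b c → ⟦ b < c ⟧ * t a b c) ≡ 3 * ∑³ ascending
  ∑-pairs≡3*∑-ascending = begin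
    ∑³ (λ a b c → ⟦ b < c ⟧ * t a b c)
      ≡⟨ ∑³-cong position-split ⟩
    ∑³ (λ a b c → ascending a b c + ascending b a c + ascending b c a)
      ≡⟨ ∑³-distrib-+₃ ascending (λ a b c → ascending b a c) (λ a b c → ascending b c a) ⟩
    ∑³ ascending + ∑³ (λ a b c → ascending b a c) + ∑³ (λ a b c → ascending b c a)
      ≡⟨ cong₂ (λ x y → ∑³ ascending + x + y) (∑³-swap₁₂ ascending) (∑³-rotate ascending) ⟩
    ∑³ ascending + ∑³ ascending + ∑³ ascending
      ≡⟨ thrice (∑³ ascending) ⟩
    3 * ∑³ ascending ∎
    where
    open ≡-Reasoning
    thrice : ∀ x → x + x + x ≡ 3 * x
    thrice = solve-∀

module _ {n : ℕ} (G : SimpleGraph n) where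

  triangle : Fin n → Fin n → Fin n → Bool
  triangle a b c = adj G a b ∧ adj G a c ∧ adj G b c

  triangle-swap : ∀ a b c → triangle a b c ≡ triangle b a c
  triangle-swap a b c rewrite symmetric G a b = cong (adj G b a ∧_) (∧-comm (adj G a c) (adj G b c))

  triangle-rotate : ∀ a b c → triangle a b c ≡ triangle b c a
  triangle-rotate a b c rewrite symmetric G a b | symmetric G a c =
    trans (sym (∧-assoc (adj G b a) (adj G c a) (adj G b c)))
          (∧-comm (adj G b a ∧ adj G c a) (adj G b c))

  triangle-degenerate : ∀ a c → triangle a a c ≡ false
  triangle-degenerate a c rewrite loopless G a = refl

  open SymmetricWeight (λ a b c → indicator (triangle a b c))
    (λ a b c → cong indicator (triangle-swap a b c))
    (λ a b c → cong indicator (triangle-rotate a b c))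
    (λ a c → cong indicator (triangle-degenerate a c))

  e≡∑-pairs : ∀ v → e G v ≡ (∑[ b < n ] ∑[ c < n ] (⟦ b < c ⟧ * indicator (triangle v b c)))
  e≡∑-pairs v = trans (length-filter-cartesianProduct _ {n} {n} id id)
    (sum-cong-≗ λ b → sum-cong-≗ λ c → indicator-∧ (does (b <? c)) (triangle v b c))

  triangleCount : ℕ
  triangleCount = ∑³ ascending

  ∑e≡3*triangleCount : (∑[ v < n ] e G v) ≡ 3 * triangleCount
  ∑e≡3*triangleCount = trans (sum-cong-≗ e≡∑-pairs) ∑-pairs≡3*∑-ascending

∑-const : ∀ n c → (∑[ i < n ] c) ≡ n * c
∑-const zero    c = refl
∑-const (suc n) c = cong (c +_) (∑-const n c)

proposition3p1 : (n r c : ℕ) (G : SimpleGraph n) → IsRCGraph G r c →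
    (n % 3 ≡ 1 ⊎ n % 3 ≡ 2) → c % 3 ≡ 0
proposition3p1 n r c G (_ , e≡c) n%3≡1⊎2 = n∣m⇒m%n≡0 c 3 3∣c
  where
  open ≡-Reasoning
  n*c≡3*triangleCount : n * c ≡ 3 * triangleCount G
  n*c≡3*triangleCount = begin
    n * c                 ≡⟨ ∑-const n c ⟨
    (∑[ v < n ] c)        ≡⟨ sum-cong-≗ e≡c ⟨
    (∑[ v < n ] e G v)    ≡⟨ ∑e≡3*triangleCount G ⟩
    3 * triangleCount G   ∎

  3∤n : ¬ 3 ∣ n
  3∤n 3∣n = [ 0≢1+n ∘ trans (sym n%3≡0) , 0≢1+n ∘ trans (sym n%3≡0) ] n%3≡1⊎2
    where
    n%3≡0 : n % 3 ≡ 0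
    n%3≡0 = n∣m⇒m%n≡0 n 3 3∣n

  3∣c : 3 ∣ c
  3∣c = [ (λ 3∣n → contradiction 3∣n 3∤n) , id ]
          (euclidsLemma n c (toWitness {a? = prime? 3} _)
            (subst (3 ∣_) (sym n*c≡3*triangleCount) (m∣m*n (triangleCount G))))
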